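{- A finite tree $T=(V,E)$ with vertex weight $w:V\to\mathbb{N}$ is $w$-Hamiltonian if and only if $w(v)\geq \deg(v)$ for all $v\in V$.
   Context: A weighted graph is $w$-Hamiltonian if there is a sequence $v_1,\dots,v_N$ of vertices with $v_t$ adjacent to $v_{t+1}$ for $t<N$ and $v_N$ adjacent to $v_1$, in which every vertex occurs and each vertex $v$ occurs at most $w(v)$ times. -}

module Defs where

open import Data.Nat using (ℕ; _≤_; _≥_)
open import Data.Fin using (Fin)
open import Data.Fin.Properties using (_≟_)
open import Data.List using (List; []; _∷_; length; filter; allFin; last)
open import Data.List.Membership.Propositional using (_∈_)
open import Data.List.Relation.Unary.Linked using (Linked)
open import Data.List.Relation.Unary.Unique.Propositional using (Unique)
open import Data.Maybe using (just)
open import Data.Product using (Σ; ∃; _×_)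
open import Data.Empty using (⊥)
open import Relation.Nullary using (¬_)
open import Relation.Binary using (Rel; Symmetric; Irreflexive; Decidable)
open import Relation.Binary.PropositionalEquality using (_≡_)
open import Relation.Binary.Construct.Closure.ReflexiveTransitive using (Star)
open import Level using (0ℓ)

record Graph (n : ℕ) : Set₁ where
  field
    Adj     : Rel (Fin n) 0ℓ
    adj?    : Decidable Adj
    sym     : Symmetric Adj
    irrefl  : Irreflexive _≡_ Adj
open Graph public

deg : ∀ {n} (G : Graph n) → Fin n → ℕ
deg {n} G v = length (filter (adj? G v) (allFin n))

occ : ∀ {n} → Fin n → List (Fin n) → ℕ
occ v xs = length (filter (_≟ v) xs)

Connected : ∀ {n} → Graph n → Set
Connected {n} G = ∀ (u v : Fin n) → Star (Adj G) u v

ClosedSeq : ∀ {n} (G : Graph n) → List (Fin n) → Set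
ClosedSeq G [] = ⊥
ClosedSeq G (x ∷ xs) =
  Linked (Adj G) (x ∷ xs) × Σ (Fin _) (λ y → last (x ∷ xs) ≡ just y × Adj G y x)

IsCycle : ∀ {n} (G : Graph n) → List (Fin n) → Set
IsCycle G xs = 3 ≤ length xs × Unique xs × ClosedSeq G xs

Acyclic : ∀ {n} → Graph n → Set
Acyclic {n} G = ∀ (xs : List (Fin n)) → ¬ IsCycle G xs

IsTree : ∀ {n} → Graph n → Set
IsTree G = Connected G × Acyclic G

WHamiltonian : ∀ {n} (G : Graph n) (w : Fin n → ℕ) → Set
WHamiltonian {n} G w =
  ∃ λ (vs : List (Fin n)) →
    ClosedSeq G vs × (∀ v → v ∈ vs) × (∀ v → occ v vs ≤ w v)

-- In an acyclic graph, whenever a neighbour u of v lies on a closed walk through v, the walk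
-- steps from v to u somewhere: otherwise the part of the walk from v to u avoids that step,
-- and its loop erasure closes up with the edge uv into a cycle.  Distinct neighbours give
-- distinct steps leaving v, so a closed walk through every vertex visits v at least deg v
-- times.  Conversely, in any connected graph a closed walk is grown by detours s → u → s
-- along edges leaving the set of visited vertices; every vertex then occurs at most as often
-- as it has visited neighbours, hence at most deg v times.
module Submission where

open import Defs renaming (sym to Adj-sym; irrefl to Adj-irrefl)
open import Data.Nat using (ℕ; zero; suc; _≤_; _≥_; _<_; z≤n; s≤s)
open import Data.Nat.Properties
  using (≤-trans; ≤-reflexive; m≤n⇒m≤1+n; <-≤-trans; ≤-pred; module ≤-Reasoning)
open import Data.Fin using (Fin; zero; suc)
open import Data.Fin.Properties using (_≟_; all?; ¬∀⟶∃¬)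
open import Data.List using (List; []; _∷_; _++_; length; filter; allFin; last)
open import Data.List.Properties
  using (length-filter; length-tabulate; filter-accept; filter-reject; filter-some)
open import Data.List.Membership.Propositional using (_∈_; _∉_; lose)
open import Data.List.Membership.Propositional.Properties using (∈-∃++; ∈-filter⁻; ∈-allFin)
open import Data.List.Relation.Binary.Subset.Propositional using (_⊆_)
open import Data.List.Relation.Binary.Permutation.Propositional
  using (_↭_; ↭-sym; ↭-trans; ↭-reflexive; module PermutationReasoning)
open import Data.List.Relation.Binary.Permutation.Propositional.Properties
  using (∈-resp-↭; ↭-length; filter-↭; shift; ++-comm)
open import Data.List.Relation.Unary.All using ([]) renaming (lookup to All-lookup)
open import Data.List.Relation.Unary.All.Properties using (¬Any⇒All¬)
open import Data.List.Relation.Unary.Any using (here; there)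
open import Data.List.Relation.Unary.AllPairs using ([]; _∷_)
open import Data.List.Relation.Unary.Linked using (Linked; [-]; _∷_) renaming (map to Linked-map)
open import Data.List.Relation.Unary.Unique.Propositional using (Unique)
open import Data.List.Relation.Unary.Unique.Propositional.Properties using (allFin⁺; filter⁺)
open import Data.Maybe using (just)
open import Data.Product using (Σ; ∃; ∃₂; _×_; _,_; proj₁; proj₂)
open import Data.Bool using (if_then_else_)
open import Function using (_∘_; id)
open import Function.Bundles using (_⇔_; mk⇔)
open import Level using (0ℓ)
open import Relation.Nullary using (¬_; yes; no; does; contradiction)
open import Relation.Nullary.Decidable using (_×-dec_; ¬?)
open import Relation.Unary using (Pred; Decidable) renaming (_⊆_ to _⊆ᵖ_)
open import Relation.Binary using (Rel; DecidableEquality)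
open import Relation.Binary.PropositionalEquality using (_≡_; _≢_; refl; sym; cong; subst)
open import Relation.Binary.Construct.Closure.ReflexiveTransitive using (Star; ε; _◅_; _◅◅_)

module _ {A : Set} {P Q : Pred A 0ℓ} (P? : Decidable P) (Q? : Decidable Q) (P⊆Q : P ⊆ᵖ Q) where

  filter-length-mono : ∀ xs → length (filter P? xs) ≤ length (filter Q? xs)
  filter-length-mono [] = z≤n
  filter-length-mono (x ∷ xs) with P? x | Q? x
  ... | yes _  | yes _  = s≤s (filter-length-mono xs)
  ... | yes px | no ¬qx = contradiction (P⊆Q px) ¬qx
  ... | no _   | yes _  = m≤n⇒m≤1+n (filter-length-mono xs)
  ... | no _   | no _   = filter-length-mono xs

  filter-length-mono-< : ∀ {x xs} → x ∈ xs → Q x → ¬ P x →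
                         length (filter P? xs) < length (filter Q? xs)
  filter-length-mono-< {xs = y ∷ xs} (here refl) qx ¬px with P? y | Q? y
  ... | yes px | _      = contradiction px ¬px
  ... | no _   | yes _  = s≤s (filter-length-mono xs)
  ... | no _   | no ¬qx = contradiction qx ¬qx
  filter-length-mono-< {xs = y ∷ xs} (there x∈xs) qx ¬px with P? y | Q? y
  ... | yes _  | yes _  = s≤s (filter-length-mono-< x∈xs qx ¬px)
  ... | yes py | no ¬qy = contradiction (P⊆Q py) ¬qy
  ... | no _   | yes _  = s≤s (filter-length-mono xs)
  ... | no _   | no _   = filter-length-mono-< x∈xs qx ¬px

Unique-⊆⇒length-≤ : ∀ {A : Set} {xs ys : List A} → Unique xs → xs ⊆ ys → length xs ≤ length ys
Unique-⊆⇒length-≤ {xs = []} _ _ = z≤n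
Unique-⊆⇒length-≤ {xs = x ∷ xs} {ys} (x∉xs ∷ !xs) x∷xs⊆ys
  with as , bs , ys≡ ← ∈-∃++ (x∷xs⊆ys (here refl)) = begin
    suc (length xs)          ≤⟨ s≤s (Unique-⊆⇒length-≤ !xs xs⊆as++bs) ⟩
    suc (length (as ++ bs))  ≡⟨ sym (↭-length σ) ⟩
    length ys                ∎
  where
    open ≤-Reasoning
    σ : ys ↭ x ∷ as ++ bs
    σ = ↭-trans (↭-reflexive ys≡) (shift x as bs)
    xs⊆as++bs : xs ⊆ as ++ bs
    xs⊆as++bs t∈xs with ∈-resp-↭ σ (x∷xs⊆ys (there t∈xs))
    ... | here t≡x = contradiction (sym t≡x) (All-lookup x∉xs t∈xs)
    ... | there t∈ = t∈

module Walk {A : Set} (_≟_ : DecidableEquality A) where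

  private variable
    R : Rel A 0ℓ
    a b c t u v : A

  open import Data.List.Membership.DecPropositional _≟_ using (_∈?_)

  -- For a closed walk, departures is the cyclic vertex sequence of ClosedSeq.
  departures : Star R a c → List A
  departures ε = []
  departures {a = a} (_ ◅ w) = a ∷ departures w

  vertices : Star R a c → List A
  vertices {a = a} ε = a ∷ []
  vertices {a = a} (_ ◅ w) = a ∷ vertices w

  successors : A → Star R a c → List A
  successors v ε = []
  successors v (_◅_ {i = a} {j = b} _ w) =
    if does (a ≟ v) then b ∷ successors v w else successors v w

  count-departures : ∀ v (w : Star R a c) →
                     length (filter (_≟ v) (departures w)) ≡ length (successors v w)
  count-departures v ε = refl
  count-departures v (_◅_ {i = a} _ w) with a ≟ v
  ... | yes _ = cong suc (count-departures v w)
  ... | no _  = count-departures v w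

  departures-◅◅ : (w₁ : Star R a b) (w₂ : Star R b c) →
                  departures (w₁ ◅◅ w₂) ≡ departures w₁ ++ departures w₂
  departures-◅◅ ε w₂ = refl
  departures-◅◅ {a = a} (_ ◅ w₁) w₂ = cong (a ∷_) (departures-◅◅ w₁ w₂)

  split : (w : Star R a c) → t ∈ departures w →
          Σ (Star R a t) λ w₁ → Σ (Star R t c) λ w₂ → w ≡ w₁ ◅◅ w₂
  split (r ◅ w) (here refl) = ε , r ◅ w , refl
  split (r ◅ w) (there t∈w) with w₁ , w₂ , refl ← split w t∈w = r ◅ w₁ , w₂ , refl

  rotate : (w : Star R a a) → t ∈ departures w →
           Σ (Star R t t) λ w′ → departures w′ ↭ departures w
  rotate w t∈w with w₁ , w₂ , refl ← split w t∈w = w₂ ◅◅ w₁ , rotated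
    where
    open PermutationReasoning
    rotated : departures (w₂ ◅◅ w₁) ↭ departures (w₁ ◅◅ w₂)
    rotated = begin
      departures (w₂ ◅◅ w₁)           ≡⟨ departures-◅◅ w₂ w₁ ⟩
      departures w₂ ++ departures w₁  ↭⟨ ++-comm (departures w₂) (departures w₁) ⟩
      departures w₁ ++ departures w₂  ≡⟨ departures-◅◅ w₁ w₂ ⟨
      departures (w₁ ◅◅ w₂)           ∎

  suffixFrom : (w : Star R a c) → t ∈ vertices w → Unique (vertices w) →
               Σ (Star R t c) (Unique ∘ vertices)
  suffixFrom ε (here refl) !w = ε , !w
  suffixFrom w@(_ ◅ _) (here refl) !w = w , !w
  suffixFrom (_ ◅ w) (there t∈w) (_ ∷ !w) = suffixFrom w t∈w !w

  loopErase : Star R a c → Σ (Star R a c) (Unique ∘ vertices)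
  loopErase ε = ε , [] ∷ []
  loopErase {a = a} (r ◅ w) with w′ , !w′ ← loopErase w | a ∈? vertices w′
  ... | yes a∈w′ = suffixFrom w′ a∈w′ !w′
  ... | no a∉w′  = r ◅ w′ , ¬Any⇒All¬ _ a∉w′ ∷ !w′

  closedWalk⇒path : (w : Star R a a) → u ∈ departures w → v ∈ departures w →
                    Σ (Star R u v) (Unique ∘ vertices)
  closedWalk⇒path w u∈w v∈w with w′ , σ ← rotate w u∈w =
    loopErase (proj₁ (split w′ (∈-resp-↭ (↭-sym σ) v∈w)))

  vertices-linked : (w : Star R a c) → Linked R (vertices w)
  vertices-linked ε = [-]
  vertices-linked (r ◅ ε) = r ∷ [-]
  vertices-linked (r ◅ w@(_ ◅ _)) = r ∷ vertices-linked w

  last-vertices : (w : Star R a c) → last (vertices w) ≡ just c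
  last-vertices ε = refl
  last-vertices (_ ◅ ε) = refl
  last-vertices (_ ◅ w@(_ ◅ _)) = last-vertices w

  length-vertices : (w : Star R a c) → 1 ≤ length (vertices w)
  length-vertices ε = s≤s z≤n
  length-vertices (_ ◅ _) = s≤s z≤n

  departures-linked : (r : R a b) (w : Star R b c) →
    Linked R (departures (r ◅ w)) × Σ A λ y → last (departures (r ◅ w)) ≡ just y × R y c
  departures-linked {a = a} r ε = [-] , a , refl , r
  departures-linked r (r′ ◅ w) with linked , y , last≡y , ryc ← departures-linked r′ w =
    r ∷ linked , y , last≡y , ryc

  linked⇒walk : ∀ {y} xs → Linked R (a ∷ xs) → last (a ∷ xs) ≡ just y → R y c →
                Σ (Star R a c) λ w → departures w ≡ a ∷ xs
  linked⇒walk [] [-] refl ryc = ryc ◅ ε , refl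
  linked⇒walk {a = a} (x ∷ xs) (rax ∷ linked) last≡y ryc
    with w , departures≡ ← linked⇒walk xs linked last≡y ryc = rax ◅ w , cong (a ∷_) departures≡

  WithoutStep : A → A → Rel A 0ℓ → Rel A 0ℓ
  WithoutStep v u R x y = R x y × ¬ (x ≡ v × y ≡ u)

  avoid : (w : Star R a c) → u ∉ successors v w →
          Σ (Star (WithoutStep v u R) a c) λ w′ → departures w′ ≡ departures w
  avoid ε _ = ε , refl
  avoid {a = a} {u = u} {v = v} (_◅_ {j = b} r w) u∉ with a ≟ v
  ... | yes refl with w′ , departures≡ ← avoid w (u∉ ∘ there) =
    (r , λ (_ , b≡u) → u∉ (here (sym b≡u))) ◅ w′ , cong (a ∷_) departures≡
  ... | no a≢v with w′ , departures≡ ← avoid w u∉ =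
    (r , a≢v ∘ proj₁) ◅ w′ , cong (a ∷_) departures≡

  frontier : ∀ {P : Pred A 0ℓ} → Decidable P → Star R a t → P a → ¬ P t →
             ∃₂ λ s u → P s × ¬ P u × R s u
  frontier P? ε pa ¬pt = contradiction pa ¬pt
  frontier P? (_◅_ {j = b} r w) pa ¬pt with P? b
  ... | yes pb = frontier P? w pb ¬pt
  ... | no ¬pb = _ , b , pa , ¬pb , r

module _ {n : ℕ} (G : Graph n) where

  open Walk (_≟_ {n})
  open import Data.List.Membership.DecPropositional (_≟_ {n}) using (_∈?_)

  private variable
    u v x : Fin n
    L L′ : List (Fin n)

  path-closes-cycle : Adj G u v → (p : Star (WithoutStep v u (Adj G)) v u) →
                      Unique (vertices p) → IsCycle G (vertices p)
  path-closes-cycle uv ε _ = contradiction uv (Adj-irrefl G refl)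
  path-closes-cycle uv (r ◅ ε) _ = contradiction (refl , refl) (proj₂ r)
  path-closes-cycle {u = u} uv p@(_ ◅ _ ◅ q) !p =
    s≤s (s≤s (length-vertices q)) , !p ,
    Linked-map proj₁ (vertices-linked p) , u , last-vertices p , uv

  neighbour-succeeds : Acyclic G → (w : Star (Adj G) x x) →
                       v ∈ departures w → u ∈ departures w → Adj G v u → u ∈ successors v w
  neighbour-succeeds {v = v} {u = u} acyclic w v∈w u∈w vu with u ∈? successors v w
  ... | yes u∈ = u∈
  ... | no u∉ with w⁻ , departures≡ ← avoid w u∉
    with path , !path ← closedWalk⇒path w⁻ (subst (v ∈_) (sym departures≡) v∈w)
                                           (subst (u ∈_) (sym departures≡) u∈w) =
    contradiction (path-closes-cycle (Adj-sym G vu) path !path) (acyclic _)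

  deg≤occ : Acyclic G → (w : Star (Adj G) x x) → (∀ t → t ∈ departures w) →
            ∀ v → deg G v ≤ occ v (departures w)
  deg≤occ acyclic w covers v = begin
    deg G v                  ≤⟨ Unique-⊆⇒length-≤ (filter⁺ (adj? G v) (allFin⁺ n)) neighbours⊆ ⟩
    length (successors v w)  ≡⟨ count-departures v w ⟨
    occ v (departures w)     ∎
    where
    open ≤-Reasoning
    neighbours⊆ : filter (adj? G v) (allFin n) ⊆ successors v w
    neighbours⊆ t∈ = neighbour-succeeds acyclic w (covers v) (covers _)
                                       (proj₂ (∈-filter⁻ (adj? G v) {xs = allFin n} t∈))

  closedSeq⇒walk : ∀ {vs} → ClosedSeq G vs → ∃ λ x → Σ (Star (Adj G) x x) λ w → departures w ≡ vs
  closedSeq⇒walk {x ∷ xs} (linked , _ , last≡y , yx) = x , linked⇒walk xs linked last≡y yx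

  departures-closedSeq : (w : Star (Adj G) x x) → x ∈ departures w → ClosedSeq G (departures w)
  departures-closedSeq (r ◅ w) _ = departures-linked r w

  wHamiltonian⇒deg≤w : Acyclic G → ∀ {wt} → WHamiltonian G wt → ∀ v → deg G v ≤ wt v
  wHamiltonian⇒deg≤w acyclic (vs , closed , covers , occ≤wt) v
    with _ , w , refl ← closedSeq⇒walk closed = ≤-trans (deg≤occ acyclic w covers v) (occ≤wt v)

  degIn : List (Fin n) → Fin n → ℕ
  degIn L v = length (filter (λ t → adj? G v t ×-dec t ∈? L) (allFin n))

  Bounded : List (Fin n) → Set
  Bounded L = ∀ v → occ v L ≤ degIn L v

  degIn-mono : L ⊆ L′ → ∀ v → degIn L v ≤ degIn L′ v
  degIn-mono L⊆L′ v = filter-length-mono _ _ (λ (vt , t∈L) → vt , L⊆L′ t∈L) (allFin n)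

  degIn≤deg : ∀ L v → degIn L v ≤ deg G v
  degIn≤deg L v = filter-length-mono _ _ proj₁ (allFin n)

  occ-↭ : L ↭ L′ → ∀ v → occ v L ≡ occ v L′
  occ-↭ σ v = ↭-length (filter-↭ (_≟ v) σ)

  occ-∉ : v ∉ L → occ v L ≡ 0
  occ-∉ {L = []} _ = refl
  occ-∉ {v = v} {L = x ∷ L} v∉ with x ≟ v
  ... | yes refl = contradiction (here refl) v∉
  ... | no _     = occ-∉ (v∉ ∘ there)

  Bounded-resp-↭ : L ↭ L′ → Bounded L → Bounded L′
  Bounded-resp-↭ {L = L} {L′ = L′} σ bounded v = begin
    occ v L′     ≡⟨ occ-↭ σ v ⟨
    occ v L      ≤⟨ bounded v ⟩
    degIn L v    ≤⟨ degIn-mono (∈-resp-↭ σ) v ⟩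
    degIn L′ v   ∎
    where open ≤-Reasoning

  Bounded-detour : ∀ {L s u} → Bounded L → u ∉ L → Adj G s u → Bounded (s ∷ u ∷ L)
  Bounded-detour {L} {s} {u} bounded u∉L su v with v ≟ s | v ≟ u
  ... | yes refl | _ = begin
    occ s (s ∷ u ∷ L)        ≡⟨ cong length (filter-accept (_≟ s) refl) ⟩
    suc (occ s (u ∷ L))      ≡⟨ cong (suc ∘ length) (filter-reject (_≟ s) u≢s) ⟩
    suc (occ s L)            ≤⟨ s≤s (bounded s) ⟩
    suc (degIn L s)          ≤⟨ filter-length-mono-< _ _ (λ (st , t∈L) → st , there (there t∈L))
                                  (∈-allFin u) (su , there (here refl)) (u∉L ∘ proj₂) ⟩
    degIn (s ∷ u ∷ L) s      ∎
    where
    open ≤-Reasoning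
    u≢s : u ≢ s
    u≢s refl = Adj-irrefl G refl su
  ... | no v≢s | yes refl = begin
    occ u (s ∷ u ∷ L)        ≡⟨ cong length (filter-reject (_≟ u) (v≢s ∘ sym)) ⟩
    occ u (u ∷ L)            ≡⟨ cong length (filter-accept (_≟ u) refl) ⟩
    suc (occ u L)            ≡⟨ cong suc (occ-∉ u∉L) ⟩
    1                        ≤⟨ filter-some _ (lose (∈-allFin s) (Adj-sym G su , here refl)) ⟩
    degIn (s ∷ u ∷ L) u      ∎
    where open ≤-Reasoning
  ... | no v≢s | no v≢u = begin
    occ v (s ∷ u ∷ L)        ≡⟨ cong length (filter-reject (_≟ v) (v≢s ∘ sym)) ⟩
    occ v (u ∷ L)            ≡⟨ cong length (filter-reject (_≟ v) (v≢u ∘ sym)) ⟩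
    occ v L                  ≤⟨ bounded v ⟩
    degIn L v                ≤⟨ degIn-mono (there ∘ there) v ⟩
    degIn (s ∷ u ∷ L) v      ∎
    where open ≤-Reasoning

  uncovered : List (Fin n) → ℕ
  uncovered L = length (filter (λ t → ¬? (t ∈? L)) (allFin n))

  uncovered-< : L ⊆ L′ → u ∉ L → u ∈ L′ → uncovered L′ < uncovered L
  uncovered-< {L = L} {L′ = L′} {u = u} L⊆L′ u∉L u∈L′ =
    filter-length-mono-< (λ t → ¬? (t ∈? L′)) (λ t → ¬? (t ∈? L)) (λ t∉L′ → t∉L′ ∘ L⊆L′)
                         (∈-allFin u) u∉L (λ u∉L′ → u∉L′ u∈L′)

  uncovered≤n : ∀ L → uncovered L ≤ n
  uncovered≤n L =
    ≤-trans (length-filter (λ t → ¬? (t ∈? L)) (allFin n)) (≤-reflexive (length-tabulate id))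

  module _ (connected : Connected G) where

    record BoundedTour : Set where
      field
        {base}   : Fin n
        walk     : Star (Adj G) base base
        base∈    : base ∈ departures walk
        bounded  : Bounded (departures walk)
    open BoundedTour

    initialTour : ∀ {a b} → a ≢ b → BoundedTour
    initialTour {a} {b} a≢b with connected a b
    ... | ε = contradiction refl a≢b
    ... | ac ◅ _ = record
      { walk = ac ◅ Adj-sym G ac ◅ ε ; base∈ = here refl
      ; bounded = Bounded-detour (λ _ → z≤n) (λ ()) ac }

    extend : ∀ {t} (T : BoundedTour) → t ∉ departures (walk T) →
             Σ BoundedTour λ T′ → uncovered (departures (walk T′)) < uncovered (departures (walk T))
    extend T t∉T
      with frontier (_∈? departures (walk T)) (connected (base T) _) (base∈ T) t∉T
    ... | s , u , s∈T , u∉T , su with walk′ , σ ← rotate (walk T) s∈T =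
      record { walk = su ◅ Adj-sym G su ◅ walk′ ; base∈ = here refl
             ; bounded = Bounded-detour (Bounded-resp-↭ (↭-sym σ) (bounded T))
                                        (u∉T ∘ ∈-resp-↭ σ) su } ,
      uncovered-< (there ∘ there ∘ ∈-resp-↭ (↭-sym σ)) u∉T (there (here refl))

    coveringTour : ∀ k (T : BoundedTour) → uncovered (departures (walk T)) ≤ k →
                   Σ BoundedTour λ T′ → ∀ t → t ∈ departures (walk T′)
    coveringTour k T uncovered≤k with all? (_∈? departures (walk T))
    ... | yes covers = T , covers
    ... | no ¬covers with k | ¬∀⟶∃¬ n _ (_∈? departures (walk T)) ¬covers
    ...   | zero  | t , t∉T =
      contradiction (≤-trans (filter-some _ (lose (∈-allFin t) t∉T)) uncovered≤k) λ ()
    ...   | suc k | t , t∉T with T′ , shrinks ← extend T t∉T =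
      coveringTour k T′ (≤-pred (<-≤-trans shrinks uncovered≤k))

    deg≤w⇒wHamiltonian : ∀ {a b} → a ≢ b → ∀ {wt} → (∀ v → deg G v ≤ wt v) → WHamiltonian G wt
    deg≤w⇒wHamiltonian a≢b deg≤wt
      with T , covers ← coveringTour n (initialTour a≢b) (uncovered≤n _) =
      departures (walk T) , departures-closedSeq (walk T) (base∈ T) , covers ,
      λ v → ≤-trans (bounded T v) (≤-trans (degIn≤deg _ v) (deg≤wt v))

mainTheorem13 : ∀ (n : ℕ) → 2 ≤ n → (T : Graph n) → IsTree T → (w : Fin n → ℕ) →
    WHamiltonian T w ⇔ (∀ v → w v ≥ deg T v)
mainTheorem13 (suc (suc _)) (s≤s (s≤s z≤n)) T (connected , acyclic) w =
  mk⇔ (wHamiltonian⇒deg≤w T acyclic) (deg≤w⇒wHamiltonian T connected {zero} {suc zero} λ ())
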